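{- Let $T$ be a rooted tree on $n$ vertices and let $M_0\subseteq V(T)$ be a set of vertices such that every connected component of the forest obtained from $T$ by deleting the vertices of $M_0$ has at most $\log n$ vertices. Let $M=\{x\in M_0 : |T(x)|\ge \log n\}$. Then for any ancestor-descendant pair $(u,v)$ in $T$ (with $u$ an ancestor of $v$), if $\mathit{path}(u,v)\cap M=\emptyset$, then $\mathit{path}(u,v)$ has at most $2\log n$ hops (edges).
   Context: $T(x)$ denotes the subtree of $T$ rooted at $x$ and $\mathit{path}(u,v)$ the tree path from $u$ to $v$. (In the paper $M_0$ is the marked set obtained from a tree partition with parameter $k=\log n$.) -}

module Defs where

open import Data.Nat using (ℕ; zero; suc; _≤_; _<_)
open import Data.Fin using (Fin; toℕ; _≟_)
open import Data.Fin.Subset using (Subset; _∈_; _∉_)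
open import Data.Fin.Properties using (any?)
open import Data.List using (List; length; filter; allFin)
open import Data.Product using (Σ; ∃; _×_; _,_)
open import Data.Sum using (_⊎_)
open import Relation.Binary.PropositionalEquality using (_≡_; _≢_)
open import Relation.Binary.Construct.Closure.ReflexiveTransitive using (Star)
open import Relation.Nullary using (¬_; Dec)

iter : ∀ {A : Set} → (A → A) → ℕ → A → A
iter f zero    x = x
iter f (suc k) x = f (iter f k x)

IsRootedTree : ∀ {n} → (Fin n → Fin n) → Fin n → Set
IsRootedTree {n} parent r = (parent r ≡ r) × (∀ v → ∃ λ k → iter parent k v ≡ r)

-- w ∈ T(x), i.e. x is an ancestor of w (or w itself).
-- (In a tree on n vertices depths are < n, so bounding the number of steps by n is harmless.)
InSubtree : ∀ {n} → (Fin n → Fin n) → Fin n → Fin n → Set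
InSubtree {n} parent x w = Σ (Fin (suc n)) λ k → iter parent (toℕ k) w ≡ x

subtreeSize : ∀ {n} → (Fin n → Fin n) → Fin n → ℕ
subtreeSize {n} parent x = length (filter dec (allFin n))
  where
  dec : (w : Fin n) → Dec (InSubtree parent x w)
  dec w = any? (λ k → iter parent (toℕ k) w ≟ x)

ForestEdge : ∀ {n} → (Fin n → Fin n) → Subset n → Fin n → Fin n → Set
ForestEdge parent M0 a b =
  (a ∉ M0) × (b ∉ M0) × (a ≢ b) × ((parent a ≡ b) ⊎ (parent b ≡ a))

ForestConn : ∀ {n} → (Fin n → Fin n) → Subset n → Fin n → Fin n → Set
ForestConn parent M0 = Star (ForestEdge parent M0)

module Submission where

-- Write p i for the i-th ancestor of v, so p k = u. Minimality of k makes p 0, …, p k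
-- distinct, and T(p i) contains p 0, …, p i, so |T(p i)| ≥ i + 1. From m = ⌈log₂ n⌉ − 1 on,
-- path vertices therefore have large subtrees and, the path avoiding M, lie outside M0:
-- p m, …, p k are distinct vertices of one component of T − M0, so k − m + 1 ≤ ⌊log₂ n⌋.
-- Since m ≤ ⌊log₂ n⌋, this gives k ≤ 2⌊log₂ n⌋ ≤ ⌊log₂ n²⌋.

open import Defs
open import Data.Nat using (ℕ; _≤_; _<_; _*_)
open import Data.Nat.Logarithm using (⌊log₂_⌋; ⌈log₂_⌉)
open import Data.Fin using (Fin)
open import Data.Fin.Subset using (Subset; _∈_; _∉_)
open import Data.List using (List; length)
open import Data.List.Relation.Unary.All using (All)
open import Data.List.Relation.Unary.Unique.Propositional using (Unique)
open import Data.Product using (_×_)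
open import Relation.Binary.PropositionalEquality using (_≡_; _≢_)
open import Relation.Nullary using (¬_)

open import Data.Nat using (zero; suc; _+_; _∸_; _^_; z≤n; s≤s; s≤s⁻¹; ⌊_/2⌋; _≤?_; NonZero)
open import Data.Nat.Properties hiding (_≟_)
open import Data.Nat.Logarithm using (⌊log₂⌋-mono-≤; ⌊log₂[2^n]⌋≡n; ⌈log₂⌉-mono-≤; ⌈log₂2^n⌉≡n)
open import Data.Nat.Logarithm.Core using (⌊log2⌋)
open import Data.Nat.Induction using (<-wellFounded)
open import Induction.WellFounded using (Acc; acc)
open import Data.Fin using (toℕ; fromℕ<; _≟_)
open import Data.Fin.Properties using (any?; injective⇒≤; toℕ-injective; toℕ<n; toℕ-fromℕ<)
open import Data.List using (filter; allFin; applyUpTo)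
open import Data.List.Properties using (length-applyUpTo)
open import Data.List.Membership.Propositional.Properties using (∈-filter⁺; ∈-allFin)
open import Data.List.Membership.Setoid.Properties using (index-injective)
open import Data.List.Relation.Unary.Any using (index)
import Data.List.Relation.Unary.All.Properties as All
import Data.List.Relation.Unary.Unique.Propositional.Properties as Unique
open import Data.Product using (_,_)
open import Data.Sum using (inj₁)
open import Function.Base using (_∘_)
open import Function.Definitions using (Injective)
open import Relation.Nullary using (yes; no; contradiction)
open import Relation.Unary using (Pred; Decidable)
open import Relation.Binary using (tri<; tri≈; tri>)
open import Relation.Binary.PropositionalEquality using (refl; sym; trans; cong; subst; setoid; module ≡-Reasoning)
open import Relation.Binary.Construct.Closure.ReflexiveTransitive using (ε; _◅_; _◅◅_)

⌊n/2⌋+⌊n/2⌋≤n : ∀ n → ⌊ n /2⌋ + ⌊ n /2⌋ ≤ n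
⌊n/2⌋+⌊n/2⌋≤n zero          = z≤n
⌊n/2⌋+⌊n/2⌋≤n (suc zero)    = z≤n
⌊n/2⌋+⌊n/2⌋≤n (suc (suc n)) =
  s≤s (≤-trans (≤-reflexive (+-suc ⌊ n /2⌋ ⌊ n /2⌋)) (s≤s (⌊n/2⌋+⌊n/2⌋≤n n)))

n≤1+⌊n/2⌋+⌊n/2⌋ : ∀ n → n ≤ suc (⌊ n /2⌋ + ⌊ n /2⌋)
n≤1+⌊n/2⌋+⌊n/2⌋ zero          = z≤n
n≤1+⌊n/2⌋+⌊n/2⌋ (suc zero)    = s≤s z≤n
n≤1+⌊n/2⌋+⌊n/2⌋ (suc (suc n)) =
  s≤s (≤-trans (s≤s (n≤1+⌊n/2⌋+⌊n/2⌋ n)) (≤-reflexive (sym (cong suc (+-suc ⌊ n /2⌋ ⌊ n /2⌋)))))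

2^⌊log2⌋≤n : ∀ n (a : Acc _<_ n) .{{_ : NonZero n}} → 2 ^ ⌊log2⌋ n a ≤ n
2^⌊log2⌋≤n (suc zero)    _        = ≤-refl
2^⌊log2⌋≤n (suc (suc n)) (acc rs) = let ih = 2^⌊log2⌋≤n (suc h) (rs (⌊n/2⌋<n (suc n))) in begin
  2 ^ L + (2 ^ L + 0)     ≤⟨ +-mono-≤ ih (+-mono-≤ ih z≤n) ⟩
  suc h + (suc h + 0)     ≡⟨ cong (suc h +_) (+-identityʳ (suc h)) ⟩
  suc h + suc h           ≡⟨ cong suc (+-suc h h) ⟩
  suc (suc (h + h))       ≤⟨ s≤s (s≤s (⌊n/2⌋+⌊n/2⌋≤n n)) ⟩
  suc (suc n)             ∎
  where
  open ≤-Reasoning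
  h = ⌊ n /2⌋
  L = ⌊log2⌋ (suc h) (rs (⌊n/2⌋<n (suc n)))

n<2^1+⌊log2⌋ : ∀ n (a : Acc _<_ n) → n < 2 ^ suc (⌊log2⌋ n a)
n<2^1+⌊log2⌋ zero          _        = s≤s z≤n
n<2^1+⌊log2⌋ (suc zero)    _        = s≤s (s≤s z≤n)
n<2^1+⌊log2⌋ (suc (suc n)) (acc rs) = let ih = n<2^1+⌊log2⌋ (suc h) (rs (⌊n/2⌋<n (suc n))) in begin-strict
  suc (suc n)                 ≤⟨ s≤s (s≤s (n≤1+⌊n/2⌋+⌊n/2⌋ n)) ⟩
  suc (suc (suc (h + h)))     <⟨ n<1+n _ ⟩
  suc (suc (suc (suc (h + h)))) ≡⟨ cong (suc ∘ suc) (sym (trans (+-suc h (suc h)) (cong suc (+-suc h h)))) ⟩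
  suc (suc h) + suc (suc h)   ≤⟨ +-mono-≤ ih (≤-trans ih (≤-reflexive (sym (+-identityʳ X)))) ⟩
  X + (X + 0)                 ∎
  where
  open ≤-Reasoning
  h = ⌊ n /2⌋
  X = 2 ^ suc (⌊log2⌋ (suc h) (rs (⌊n/2⌋<n (suc n))))

⌈log₂n⌉≤1+⌊log₂n⌋ : ∀ n → ⌈log₂ n ⌉ ≤ suc ⌊log₂ n ⌋
⌈log₂n⌉≤1+⌊log₂n⌋ n = begin
  ⌈log₂ n ⌉                  ≤⟨ ⌈log₂⌉-mono-≤ (<⇒≤ (n<2^1+⌊log2⌋ n (<-wellFounded n))) ⟩
  ⌈log₂ 2 ^ suc ⌊log₂ n ⌋ ⌉  ≡⟨ ⌈log₂2^n⌉≡n (suc ⌊log₂ n ⌋) ⟩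
  suc ⌊log₂ n ⌋              ∎
  where open ≤-Reasoning

⌊log₂m⌋+⌊log₂n⌋≤⌊log₂m*n⌋ : ∀ m n .{{_ : NonZero m}} .{{_ : NonZero n}} →
                             ⌊log₂ m ⌋ + ⌊log₂ n ⌋ ≤ ⌊log₂ (m * n) ⌋
⌊log₂m⌋+⌊log₂n⌋≤⌊log₂m*n⌋ m n = begin
  ⌊log₂ m ⌋ + ⌊log₂ n ⌋                  ≡⟨ sym (⌊log₂[2^n]⌋≡n _) ⟩
  ⌊log₂ 2 ^ (⌊log₂ m ⌋ + ⌊log₂ n ⌋) ⌋    ≡⟨ cong ⌊log₂_⌋ (^-distribˡ-+-* 2 ⌊log₂ m ⌋ ⌊log₂ n ⌋) ⟩
  ⌊log₂ 2 ^ ⌊log₂ m ⌋ * 2 ^ ⌊log₂ n ⌋ ⌋  ≤⟨ ⌊log₂⌋-mono-≤ (*-mono-≤ (2^⌊log2⌋≤n m _) (2^⌊log2⌋≤n n _)) ⟩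
  ⌊log₂ (m * n) ⌋                        ∎
  where open ≤-Reasoning

DistinctBelow : ∀ {A : Set} → ℕ → (ℕ → A) → Set
DistinctBelow m g = ∀ {i j} → i < j → j < m → g i ≢ g j

distinctBelow-mono : ∀ {A : Set} {d e} {g : ℕ → A} → d ≤ e → DistinctBelow e g → DistinctBelow d g
distinctBelow-mono d≤e dist i<j j<d = dist i<j (≤-trans j<d d≤e)

distinctBelow-shift : ∀ {A : Set} {d} m {g : ℕ → A} →
                      DistinctBelow (d + m) g → DistinctBelow d (λ t → g (t + m))
distinctBelow-shift m dist i<j j<d = dist (+-monoˡ-< m i<j) (+-monoˡ-< m j<d)

distinctBelow⇒injective : ∀ {A : Set} {m} {g : ℕ → A} → DistinctBelow m g →
                          Injective _≡_ _≡_ (λ (t : Fin m) → g (toℕ t))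
distinctBelow⇒injective dist {s} {t} eq with <-cmp (toℕ s) (toℕ t)
... | tri< s<t _ _ = contradiction eq (dist s<t (toℕ<n t))
... | tri≈ _ s≡t _ = toℕ-injective s≡t
... | tri> _ _ t<s = contradiction (sym eq) (dist t<s (toℕ<n s))

count-distinctBelow : ∀ {n m p} {P : Pred (Fin n) p} (P? : Decidable P) {g : ℕ → Fin n} →
                      DistinctBelow m g → (∀ {i} → i < m → P (g i)) →
                      m ≤ length (filter P? (allFin n))
count-distinctBelow {n} P? {g} dist Pg = injective⇒≤ {f = position} position-injective
  where
  member = λ t → ∈-filter⁺ P? (∈-allFin (g (toℕ t))) (Pg (toℕ<n t))
  position = λ t → index (member t)
  position-injective : Injective _≡_ _≡_ position
  position-injective eq =
    distinctBelow⇒injective dist (index-injective (setoid (Fin n)) (member _) (member _) eq)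

iter-+ : ∀ {A : Set} (f : A → A) a b x → iter f (a + b) x ≡ iter f a (iter f b x)
iter-+ f zero    b x = refl
iter-+ f (suc a) b x = cong f (iter-+ f a b x)

iter-∸ : ∀ {A : Set} (f : A → A) {i j} x → j ≤ i → iter f (i ∸ j) (iter f j x) ≡ iter f i x
iter-∸ f {i} {j} x j≤i = trans (sym (iter-+ f (i ∸ j) j x)) (cong (λ e → iter f e x) (m∸n+n≡m j≤i))

-- A repetition at steps i < j would let x reach u already at step k − (j − i).
iter-distinctBelow-firstHit : ∀ {A : Set} (f : A → A) {x u k} → iter f k x ≡ u →
                              (∀ i → i < k → iter f i x ≢ u) →
                              DistinctBelow (suc k) (λ i → iter f i x)
iter-distinctBelow-firstHit f {x} {u} {k} hit first {i} {j} i<j j<1+k eq =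
  first (k ∸ j + i) earlier hits
  where
  j≤k = s≤s⁻¹ j<1+k

  earlier : k ∸ j + i < k
  earlier = begin-strict
    k ∸ j + i   <⟨ +-monoʳ-< (k ∸ j) i<j ⟩
    k ∸ j + j   ≡⟨ m∸n+n≡m j≤k ⟩
    k           ∎
    where open ≤-Reasoning

  hits : iter f (k ∸ j + i) x ≡ u
  hits = begin
    iter f (k ∸ j + i) x         ≡⟨ iter-+ f (k ∸ j) i x ⟩
    iter f (k ∸ j) (iter f i x)  ≡⟨ cong (iter f (k ∸ j)) eq ⟩
    iter f (k ∸ j) (iter f j x)  ≡⟨ iter-∸ f x j≤k ⟩
    iter f k x                   ≡⟨ hit ⟩
    u                            ∎
    where open ≡-Reasoning

IsParentChain : ∀ {n} → (Fin n → Fin n) → (ℕ → Fin n) → Set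
IsParentChain parent g = ∀ t → g (suc t) ≡ parent (g t)

module _ {n} (parent : Fin n → Fin n) where

  distinctAncestors⇒subtreeSize : ∀ {v i} → DistinctBelow (suc i) (λ j → iter parent j v) →
                                  suc i ≤ subtreeSize parent (iter parent i v)
  distinctAncestors⇒subtreeSize {v} {i} dist = count-distinctBelow inSubtree? dist below
    where
    inSubtree? = λ w → any? (λ s → iter parent (toℕ s) w ≟ iter parent i v)

    i<n : i < n
    i<n = injective⇒≤ (distinctBelow⇒injective dist)

    below : ∀ {j} → j < suc i → InSubtree parent (iter parent i v) (iter parent j v)
    below {j} j<1+i = fromℕ< i∸j<1+n , trans (cong (λ e → iter parent e _) (toℕ-fromℕ< i∸j<1+n))
                                             (iter-∸ parent v (s≤s⁻¹ j<1+i))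
      where
      i∸j<1+n : i ∸ j < suc n
      i∸j<1+n = s≤s (≤-trans (m∸n≤m i j) (<⇒≤ i<n))

  module _ {M0 : Subset n} {g : ℕ → Fin n} {d} (chain : IsParentChain parent g)
           (dist : DistinctBelow (suc d) g) (outside : ∀ t → t ≤ d → g t ∉ M0) where

    chain-forestConn : ∀ t → t ≤ d → ForestConn parent M0 (g 0) (g t)
    chain-forestConn zero    _   = ε
    chain-forestConn (suc t) t<d = chain-forestConn t (<⇒≤ t<d) ◅◅ (edge ◅ ε)
      where
      edge : ForestEdge parent M0 (g t) (g (suc t))
      edge = outside t (<⇒≤ t<d) , outside (suc t) t<d , dist (n<1+n t) (s≤s t<d) , inj₁ (sym (chain t))

    chain-length≤ : ∀ {B} → (∀ ws → Unique ws → All (ForestConn parent M0 (g 0)) ws → length ws ≤ B) →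
                    suc d ≤ B
    chain-length≤ {B} bound = subst (_≤ B) (length-applyUpTo g (suc d))
      (bound (applyUpTo g (suc d)) (Unique.applyUpTo⁺₁ g (suc d) dist)
        (All.applyUpTo⁺₁ g (suc d) (λ t<1+d → chain-forestConn _ (s≤s⁻¹ t<1+d))))

lemma10 : (n : ℕ) (parent : Fin n → Fin n) (r : Fin n) → IsRootedTree parent r →
    (M0 : Subset n) →
    (∀ x → x ∉ M0 → (ws : List (Fin n)) → Unique ws →
      All (ForestConn parent M0 x) ws → length ws ≤ ⌊log₂ n ⌋) →
    (u v : Fin n) (k : ℕ) → iter parent k v ≡ u →
    (∀ i → i < k → iter parent i v ≢ u) →
    (∀ i → i ≤ k → ¬ ((iter parent i v ∈ M0) × (⌈log₂ n ⌉ ≤ subtreeSize parent (iter parent i v)))) →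
    k ≤ ⌊log₂ (n * n) ⌋
lemma10 zero _ _ _ _ _ ()
lemma10 n@(suc _) parent _ _ M0 componentBound u v k hit first avoidsM = begin
  k                      ≤⟨ m≤n+m∸n k m ⟩
  m + (k ∸ m)            ≤⟨ +-mono-≤ m≤⌊log₂n⌋ tail≤⌊log₂n⌋ ⟩
  ⌊log₂ n ⌋ + ⌊log₂ n ⌋  ≤⟨ ⌊log₂m⌋+⌊log₂n⌋≤⌊log₂m*n⌋ n n ⟩
  ⌊log₂ (n * n) ⌋        ∎
  where
  open ≤-Reasoning
  p = λ i → iter parent i v
  m = ⌈log₂ n ⌉ ∸ 1

  m≤⌊log₂n⌋ : m ≤ ⌊log₂ n ⌋
  m≤⌊log₂n⌋ = ∸-monoˡ-≤ 1 (⌈log₂n⌉≤1+⌊log₂n⌋ n)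

  dist : DistinctBelow (suc k) p
  dist = iter-distinctBelow-firstHit parent hit first

  outside : ∀ i → m ≤ i → i ≤ k → p i ∉ M0
  outside i m≤i i≤k i∈M0 = avoidsM i i≤k (i∈M0 , ≤-trans (m≤n+m∸n ⌈log₂ n ⌉ 1)
    (≤-trans (s≤s m≤i) (distinctAncestors⇒subtreeSize parent (distinctBelow-mono (s≤s i≤k) dist))))

  tail≤⌊log₂n⌋ : k ∸ m ≤ ⌊log₂ n ⌋
  tail≤⌊log₂n⌋ with m ≤? k
  ... | no m≰k  = subst (_≤ ⌊log₂ n ⌋) (sym (m≤n⇒m∸n≡0 (<⇒≤ (≰⇒> m≰k)))) z≤n
  ... | yes m≤k = <⇒≤ (chain-length≤ parent (λ _ → refl) tailDistinct tailOutside
                                     (componentBound (p m) (outside m ≤-refl m≤k)))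
    where
    k∸m+m≡k = m∸n+n≡m m≤k
    tailDistinct : DistinctBelow (suc (k ∸ m)) (λ t → p (t + m))
    tailDistinct = distinctBelow-shift m (distinctBelow-mono (≤-reflexive (cong suc k∸m+m≡k)) dist)
    tailOutside : ∀ t → t ≤ k ∸ m → p (t + m) ∉ M0
    tailOutside t t≤ = outside (t + m) (m≤n+m m t) (≤-trans (+-monoˡ-≤ m t≤) (≤-reflexive k∸m+m≡k))
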